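{- Let $\Phi,\Gamma,\Delta\in W^c_{\vdash_{\mathbf{SU}}}$ with $\Phi\subseteq\Gamma\cap\Delta$, and let $\Theta=\Phi\cup\{\neg\alpha\to\beta:\alpha\in\Gamma,\beta\in\Delta\}\cup\{\neg\beta\to\alpha:\beta\in\Delta,\alpha\in\Gamma\}$. Then $\Theta\subseteq\Gamma\cap\Delta$, and for every $n\ge1$ and all formulas $\alpha_0,\dots,\alpha_n$: if $\Theta\vdash_{\mathbf{SU}}\alpha_0\lor\dots\lor\alpha_n$, then $\alpha_i\in\Gamma\cap\Delta$ for some $i\in\{0,\dots,n\}$.
   Context: Formulas are built from countably many propositional variables and $\bot$ with $\land,\lor,\to$; $\neg\alpha$ abbreviates $\alpha\to\bot$. $\vdash_{\mathbf{SU}}$ is the consequence relation of a Hilbert system for intuitionistic propositional logic (with modus ponens) extended by all substitution instances of $\boldsymbol{su} = ((\neg p\to q)\land(\neg q\to p) \rightarrow r \vee s) \to ( p \rightarrow r) \vee(q \rightarrow s)$ as axioms. $W^c_{\vdash_{\mathbf{SU}}}$ is the set of all sets $\Gamma$ of formulas that are $\vdash_{\mathbf{SU}}$-consistent ($\Gamma\nvdash_{\mathbf{SU}}\bot$), $\vdash_{\mathbf{SU}}$-closed ($\Gamma\vdash_{\mathbf{SU}}\varphi$ implies $\varphi\in\Gamma$) and disjunction complete ($\varphi\lor\psi\in\Gamma$ implies $\varphi\in\Gamma$ or $\psi\in\Gamma$). -}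

module Defs where

open import Data.Nat using (ℕ; zero; suc)
open import Data.Fin using (Fin; zero; suc)
open import Data.Product using (_×_; ∃; ∃-syntax; _,_)
open import Data.Sum using (_⊎_)
open import Relation.Nullary using (¬_)

infixr 6 _∧'_
infixr 5 _∨'_
infixr 4 _⇒_

data Formula : Set where
  var  : ℕ → Formula
  ⊥'   : Formula
  _∧'_ : Formula → Formula → Formula
  _∨'_ : Formula → Formula → Formula
  _⇒_  : Formula → Formula → Formula

∼_ : Formula → Formula
∼ a = a ⇒ ⊥'

FSet : Set₁
FSet = Formula → Set

_⊆_ : FSet → FSet → Set
A ⊆ B = ∀ φ → A φ → B φ

_∩_ : FSet → FSet → FSet
(A ∩ B) φ = A φ × B φ

data Axiom : Formula → Set where
  K     : ∀ a b → Axiom (a ⇒ b ⇒ a)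
  S     : ∀ a b c → Axiom ((a ⇒ b ⇒ c) ⇒ (a ⇒ b) ⇒ a ⇒ c)
  ∧E₁   : ∀ a b → Axiom (a ∧' b ⇒ a)
  ∧E₂   : ∀ a b → Axiom (a ∧' b ⇒ b)
  ∧I    : ∀ a b → Axiom (a ⇒ b ⇒ a ∧' b)
  ∨I₁   : ∀ a b → Axiom (a ⇒ a ∨' b)
  ∨I₂   : ∀ a b → Axiom (b ⇒ a ∨' b)
  ∨E    : ∀ a b c → Axiom ((a ⇒ c) ⇒ (b ⇒ c) ⇒ a ∨' b ⇒ c)
  exf   : ∀ a → Axiom (⊥' ⇒ a)
  su    : ∀ p q r s →
          Axiom ((((∼ p) ⇒ q) ∧' ((∼ q) ⇒ p) ⇒ r ∨' s) ⇒ (p ⇒ r) ∨' (q ⇒ s))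

infix 3 _⊢SU_
data _⊢SU_ (Γ : FSet) : Formula → Set where
  assum : ∀ {φ} → Γ φ → Γ ⊢SU φ
  ax    : ∀ {φ} → Axiom φ → Γ ⊢SU φ
  mp    : ∀ {φ ψ} → Γ ⊢SU φ ⇒ ψ → Γ ⊢SU φ → Γ ⊢SU ψ

record InWc (Γ : FSet) : Set where
  field
    consistent : ¬ (Γ ⊢SU ⊥')
    closed     : ∀ φ → Γ ⊢SU φ → Γ φ
    disjComplete : ∀ φ ψ → Γ (φ ∨' ψ) → Γ φ ⊎ Γ ψ

data Theta (Φ Γ Δ : FSet) : FSet where
  fromΦ : ∀ {φ} → Φ φ → Theta Φ Γ Δ φ
  left  : ∀ {α β} → Γ α → Δ β → Theta Φ Γ Δ ((∼ α) ⇒ β)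
  right : ∀ {α β} → Δ β → Γ α → Theta Φ Γ Δ ((∼ β) ⇒ α)

⋁ : ∀ n → (Fin (suc n) → Formula) → Formula
⋁ zero    f = f zero
⋁ (suc n) f = f zero ∨' ⋁ n (λ i → f (suc i))

{-# OPTIONS --safe #-}
module Submission where

-- A derivation from Θ uses finitely many of its members, and Γ and Δ are closed
-- under conjunction, so Θ ⊢ φ gives Φ ⊢ (¬α → β) ∧ (¬β → α) → φ for a single
-- α ∈ Γ and β ∈ Δ.  With the axiom su and the primality of Φ, a derivation
-- Θ ⊢ A ∨ B therefore yields A ∈ Γ or B ∈ Δ.  Splitting α₀ ∨ … ∨ αₙ along a set
-- p of indices as ⋁_{i∈p} αᵢ ∨ ⋁_{i∉p} αᵢ, we shrink p, starting from all indices,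
-- while every αᵢ with i ∉ p lies in Γ: either some αᵢ with i ∈ p lies in Γ and is
-- removed from p, or some αᵢ with i ∉ p lies in Δ, and hence in Γ ∩ Δ.

open import Defs
open import Data.Nat using (ℕ; zero; suc; _≥_)
open import Data.Fin using (Fin; zero; suc; _≟_)
open import Data.Fin.Subset
  using (Subset; Side; inside; outside; _∈_; _⊂_; ∁; _-_) renaming (⊤ to all)
open import Data.Fin.Subset.Properties
  using (∈⊤; x∈∁p⇒x∉p; x∉p⇒x∈∁p; x∈p∧x≢y⇒x∈p-y; x∈p⇒p-x⊂p)
open import Data.Fin.Subset.Induction using (Acc; acc; ⊂-wellFounded)
open import Data.Vec using (_∷_; []; here; there)
open import Data.Product using (_×_; ∃-syntax; _,_)
open import Data.Sum using (_⊎_; inj₁; inj₂)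
open import Data.Empty using (⊥-elim)
open import Function using (_∘_)
open import Relation.Nullary using (yes; no)
open import Relation.Binary.PropositionalEquality using (_≡_; refl)

private
  variable
    G H : FSet
    a a′ b b′ c φ : Formula
    n : ℕ

infixl 4 _▸_
_▸_ : FSet → Formula → FSet
(G ▸ a) φ = G φ ⊎ φ ≡ a

⊢-mono : G ⊆ H → G ⊢SU φ → H ⊢SU φ
⊢-mono G⊆H (assum x) = assum (G⊆H _ x)
⊢-mono G⊆H (ax x)    = ax x
⊢-mono G⊆H (mp d e)  = mp (⊢-mono G⊆H d) (⊢-mono G⊆H e)

weaken : G ⊢SU φ → G ▸ a ⊢SU φ
weaken = ⊢-mono (λ _ → inj₁)

hyp : G ▸ a ⊢SU a
hyp = assum (inj₂ refl)

⇒-refl : G ⊢SU a ⇒ a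
⇒-refl {a = a} = mp (mp (ax (S a (a ⇒ a) a)) (ax (K a (a ⇒ a)))) (ax (K a a))

⇒-const : G ⊢SU b → G ⊢SU a ⇒ b
⇒-const = mp (ax (K _ _))

deduction : G ▸ a ⊢SU b → G ⊢SU a ⇒ b
deduction (assum (inj₁ x))    = ⇒-const (assum x)
deduction (assum (inj₂ refl)) = ⇒-refl
deduction (ax x)              = ⇒-const (ax x)
deduction (mp d e)            = mp (mp (ax (S _ _ _)) (deduction d)) (deduction e)

⇒-elim-hyp : G ⊢SU a ⇒ b → G ▸ a ⊢SU b
⇒-elim-hyp d = mp (weaken d) hyp

∧-intro : G ⊢SU a → G ⊢SU b → G ⊢SU a ∧' b
∧-intro d e = mp (mp (ax (∧I _ _)) d) e

∧-elimˡ : G ⊢SU a ∧' b → G ⊢SU a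
∧-elimˡ = mp (ax (∧E₁ _ _))

∧-elimʳ : G ⊢SU a ∧' b → G ⊢SU b
∧-elimʳ = mp (ax (∧E₂ _ _))

∨-introˡ : G ⊢SU a → G ⊢SU a ∨' b
∨-introˡ = mp (ax (∨I₁ _ _))

∨-introʳ : G ⊢SU b → G ⊢SU a ∨' b
∨-introʳ = mp (ax (∨I₂ _ _))

∨-elim : G ⊢SU a ∨' b → G ▸ a ⊢SU c → G ▸ b ⊢SU c → G ⊢SU c
∨-elim d l r = mp (mp (mp (ax (∨E _ _ _)) (deduction l)) (deduction r)) d

⇒-trans : G ⊢SU a ⇒ b → G ⊢SU b ⇒ c → G ⊢SU a ⇒ c
⇒-trans d e = deduction (mp (weaken e) (⇒-elim-hyp d))

contraposition : G ⊢SU a ⇒ a′ → G ⊢SU ∼ a′ ⇒ ∼ a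
contraposition d =
  deduction (deduction (mp (assum (inj₁ (inj₂ refl))) (⇒-elim-hyp (weaken d))))

contradiction-⇒ : G ⊢SU a → G ⊢SU ∼ a ⇒ b
contradiction-⇒ d = deduction (mp (ax (exf _)) (mp hyp (weaken d)))

-- The antecedent of su; the members of Θ outside Φ are the conjuncts of α ⋈ β
-- with α ∈ Γ and β ∈ Δ.
infix 5 _⋈_
_⋈_ : Formula → Formula → Formula
a ⋈ b = (∼ a ⇒ b) ∧' (∼ b ⇒ a)

⋈-mono : G ⊢SU a ⇒ a′ → G ⊢SU b ⇒ b′ → G ⊢SU a ⋈ b ⇒ a′ ⋈ b′
⋈-mono da db = deduction (∧-intro
  (⇒-trans (weaken (contraposition da)) (⇒-trans (∧-elimˡ hyp) (weaken db)))
  (⇒-trans (weaken (contraposition db)) (⇒-trans (∧-elimʳ hyp) (weaken da))))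

⊤' : Formula
⊤' = ⊥' ⇒ ⊥'

module _ {Φ Γ Δ : FSet}
         (Γ-closed : ∀ φ → Γ ⊢SU φ → Γ φ) (Δ-closed : ∀ φ → Δ ⊢SU φ → Δ φ) where

  Theta-compact : Theta Φ Γ Δ ⊢SU φ → ∃[ α ] ∃[ β ] Γ α × Δ β × Φ ⊢SU α ⋈ β ⇒ φ
  Theta-compact (assum (fromΦ x)) =
    ⊤' , ⊤' , Γ-closed _ ⇒-refl , Δ-closed _ ⇒-refl , ⇒-const (assum x)
  Theta-compact (assum (left {α} {β} α∈Γ β∈Δ))  = α , β , α∈Γ , β∈Δ , ax (∧E₁ _ _)
  Theta-compact (assum (right {α} {β} β∈Δ α∈Γ)) = α , β , α∈Γ , β∈Δ , ax (∧E₂ _ _)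
  Theta-compact (ax x) = ⊤' , ⊤' , Γ-closed _ ⇒-refl , Δ-closed _ ⇒-refl , ⇒-const (ax x)
  Theta-compact (mp d e)
    with α₁ , β₁ , α₁∈Γ , β₁∈Δ , d′ ← Theta-compact d
       | α₂ , β₂ , α₂∈Γ , β₂∈Δ , e′ ← Theta-compact e =
    α₁ ∧' α₂ , β₁ ∧' β₂ ,
    Γ-closed _ (∧-intro (assum α₁∈Γ) (assum α₂∈Γ)) ,
    Δ-closed _ (∧-intro (assum β₁∈Δ) (assum β₂∈Δ)) ,
    deduction (mp (⇒-elim-hyp (⇒-trans (⋈-mono (ax (∧E₁ _ _)) (ax (∧E₁ _ _))) d′))
                  (⇒-elim-hyp (⇒-trans (⋈-mono (ax (∧E₂ _ _)) (ax (∧E₂ _ _))) e′)))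

  Theta⊆∩ : Φ ⊆ (Γ ∩ Δ) → Theta Φ Γ Δ ⊆ (Γ ∩ Δ)
  Theta⊆∩ Φ⊆Γ∩Δ φ (fromΦ φ∈Φ) = Φ⊆Γ∩Δ φ φ∈Φ
  Theta⊆∩ Φ⊆Γ∩Δ _ (left α∈Γ β∈Δ) =
    Γ-closed _ (contradiction-⇒ (assum α∈Γ)) ,
    Δ-closed _ (⇒-const (assum β∈Δ))
  Theta⊆∩ Φ⊆Γ∩Δ _ (right β∈Δ α∈Γ) =
    Γ-closed _ (⇒-const (assum α∈Γ)) ,
    Δ-closed _ (contradiction-⇒ (assum β∈Δ))

  Theta-split : InWc Φ → Φ ⊆ (Γ ∩ Δ) → Theta Φ Γ Δ ⊢SU a ∨' b → Γ a ⊎ Δ b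
  Theta-split {a} {b} wΦ Φ⊆Γ∩Δ d
    with α , β , α∈Γ , β∈Δ , d′ ← Theta-compact d
    with InWc.disjComplete wΦ _ _ (InWc.closed wΦ _ (mp (ax (su α β a b)) d′))
  ... | inj₁ α⇒a∈Φ with α⇒a∈Γ , _ ← Φ⊆Γ∩Δ _ α⇒a∈Φ =
    inj₁ (Γ-closed _ (mp (assum α⇒a∈Γ) (assum α∈Γ)))
  ... | inj₂ β⇒b∈Φ with _ , β⇒b∈Δ ← Φ⊆Γ∩Δ _ β⇒b∈Φ =
    inj₂ (Δ-closed _ (mp (assum β⇒b∈Δ) (assum β∈Δ)))

⋁[_]_ : Subset n → (Fin n → Formula) → Formula
⋁[ [] ]          α = ⊥'
⋁[ inside ∷ p ]  α = α zero ∨' ⋁[ p ] (α ∘ suc)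
⋁[ outside ∷ p ] α = ⋁[ p ] (α ∘ suc)

module _ {α : Fin (suc n) → Formula} where

  ⋁[]-split-head : (s : Side) {p : Subset n} →
                   G ⊢SU α zero ⇒ ⋁[ s ∷ p ] α ∨' ⋁[ ∁ (s ∷ p) ] α
  ⋁[]-split-head inside  = deduction (∨-introˡ (∨-introˡ hyp))
  ⋁[]-split-head outside = deduction (∨-introʳ (∨-introˡ hyp))

  ⋁[]-split-tail : (s : Side) {p : Subset n} →
                   G ⊢SU ⋁[ p ] (α ∘ suc) ∨' ⋁[ ∁ p ] (α ∘ suc)
                         ⇒ ⋁[ s ∷ p ] α ∨' ⋁[ ∁ (s ∷ p) ] α
  ⋁[]-split-tail inside  = deduction (∨-elim hyp (∨-introˡ (∨-introʳ hyp)) (∨-introʳ hyp))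
  ⋁[]-split-tail outside = deduction (∨-elim hyp (∨-introˡ hyp) (∨-introʳ (∨-introʳ hyp)))

⋁-split : ∀ n {α : Fin (suc n) → Formula} (p : Subset (suc n)) →
          G ⊢SU ⋁ n α ⇒ ⋁[ p ] α ∨' ⋁[ ∁ p ] α
⋁-split zero    (s ∷ []) = ⋁[]-split-head s
⋁-split (suc n) (s ∷ p)  = deduction (∨-elim hyp
  (⇒-elim-hyp (⋁[]-split-head s))
  (⇒-elim-hyp (⇒-trans (⋁-split n p) (⋁[]-split-tail s))))

⋁[]-member : InWc G → {p : Subset n} {α : Fin n → Formula} →
             G (⋁[ p ] α) → ∃[ i ] i ∈ p × G (α i)
⋁[]-member wG {[]} ⊥∈G = ⊥-elim (InWc.consistent wG (assum ⊥∈G))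
⋁[]-member wG {inside ∷ p} d with InWc.disjComplete wG _ _ d
... | inj₁ α₀∈G = zero , here , α₀∈G
... | inj₂ d′ with i , i∈p , αi∈G ← ⋁[]-member wG d′ = suc i , there i∈p , αi∈G
⋁[]-member wG {outside ∷ p} d with i , i∈p , αi∈G ← ⋁[]-member wG d = suc i , there i∈p , αi∈G

common-disjunct : InWc G → InWc H → {α : Fin n → Formula} →
                  (∀ p → G (⋁[ p ] α) ⊎ H (⋁[ ∁ p ] α)) → ∃[ i ] (G ∩ H) (α i)
common-disjunct {G} {H} wG wH {α} split =
  shrink all (⊂-wellFounded all) (λ i∈∁all → ⊥-elim (x∈∁p⇒x∉p i∈∁all ∈⊤))
  where
  shrink : ∀ p → Acc _⊂_ p → (∀ {i} → i ∈ ∁ p → G (α i)) → ∃[ i ] (G ∩ H) (α i)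
  shrink p (acc smaller) outside⊆G with split p
  ... | inj₂ d with i , i∈∁p , αi∈H ← ⋁[]-member wH d = i , outside⊆G i∈∁p , αi∈H
  ... | inj₁ d with i , i∈p , αi∈G ← ⋁[]-member wG d =
    shrink (p - i) (smaller (x∈p⇒p-x⊂p i∈p)) outside⊆G′
    where
    outside⊆G′ : ∀ {j} → j ∈ ∁ (p - i) → G (α j)
    outside⊆G′ {j} j∈∁p-i with j ≟ i
    ... | yes refl = αi∈G
    ... | no j≢i   = outside⊆G (x∉p⇒x∈∁p λ j∈p →
                       x∈∁p⇒x∉p j∈∁p-i (x∈p∧x≢y⇒x∈p-y j∈p j≢i))

lemma11 : (Φ Γ Δ : FSet) → InWc Φ → InWc Γ → InWc Δ → Φ ⊆ (Γ ∩ Δ) →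
          (Theta Φ Γ Δ ⊆ (Γ ∩ Δ))
          × (∀ (n : ℕ) → n ≥ 1 → (α : Fin (suc n) → Formula) →
               Theta Φ Γ Δ ⊢SU ⋁ n α → ∃[ i ] (Γ ∩ Δ) (α i))
lemma11 Φ Γ Δ wΦ wΓ wΔ Φ⊆Γ∩Δ =
  Theta⊆∩ Γ-closed Δ-closed Φ⊆Γ∩Δ ,
  λ n _ α d → common-disjunct wΓ wΔ λ p →
    Theta-split Γ-closed Δ-closed wΦ Φ⊆Γ∩Δ (mp (⋁-split n p) d)
  where
  Γ-closed : ∀ φ → Γ ⊢SU φ → Γ φ
  Γ-closed = InWc.closed wΓ
  Δ-closed : ∀ φ → Δ ⊢SU φ → Δ φ
  Δ-closed = InWc.closed wΔ
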